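{- For all integers $m \geq 2$ and $f$ with $0 \leq f \leq \binom{m}{2}$, there exists a constant $c>0$ such that for every positive integer $n$, $h_2(n,m,f) > c\, n^{1/(m-1)}$.
   Context: All graphs are simple. For a graph $G$, a homogeneous set is a set of vertices that is a clique or an independent set, and $h(G)$ denotes the size of a largest homogeneous set. An $(m,f)$-graph is a graph with $m$ vertices and $f$ edges. A graph $G$ is $(m,f)$-free if no $m$-vertex subset of $V(G)$ induces exactly $f$ edges. $h_2(n,m,f)$ denotes the minimum of $h(G)$ over all $n$-vertex $(m,f)$-free graphs $G$. -}

module Defs where

open import Data.Nat using (ℕ; zero; suc; _+_; _*_; _<_; _<ᵇ_)
open import Data.Bool using (Bool; true; false; _∧_; if_then_else_)
open import Data.Fin using (Fin; toℕ)
open import Data.Fin.Subset using (Subset; _∈_; ∣_∣)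
open import Data.List using (List; map; allFin)
open import Data.Nat.ListAction using (sum)
open import Data.Vec using (lookup)
open import Data.Product using (_×_)
open import Data.Sum using (_⊎_)
open import Relation.Binary.PropositionalEquality using (_≡_; _≢_)
open import Relation.Nullary using (¬_)

record Graph (n : ℕ) : Set where
  field
    adj   : Fin n → Fin n → Bool
    sym   : ∀ i j → adj i j ≡ adj j i
    irrefl : ∀ i → adj i i ≡ false
open Graph public

inducedEdges : ∀ {n} → Graph n → Subset n → ℕ
inducedEdges {n} G S =
  sum (map (λ i → sum (map (λ j →
    if ((toℕ i <ᵇ toℕ j) ∧ lookup S i ∧ lookup S j ∧ adj G i j) then 1 else 0)
    (allFin n))) (allFin n))

MFFree : ∀ {n} → Graph n → ℕ → ℕ → Set
MFFree G m f = ∀ S → ∣ S ∣ ≡ m → ¬ (inducedEdges G S ≡ f)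

IsClique : ∀ {n} → Graph n → Subset n → Set
IsClique G S = ∀ i j → i ∈ S → j ∈ S → i ≢ j → adj G i j ≡ true

IsIndependent : ∀ {n} → Graph n → Subset n → Set
IsIndependent G S = ∀ i j → i ∈ S → j ∈ S → i ≢ j → adj G i j ≡ false

Homogeneous : ∀ {n} → Graph n → Subset n → Set
Homogeneous G S = IsClique G S ⊎ IsIndependent G S

module Submission where

-- Fix a threshold sequence e₁ … eₘ with Σ_{eᵢ} (m − i) = f (possible for every f ≤ C(m,2)):
-- vertices v₁ … vₘ with vᵢ joined to every later vⱼ exactly when eᵢ induce exactly f edges, so an
-- (m,f)-free graph contains no such configuration.  Build one greedily, Erdős–Szekeres style: in a
-- pool of at least t·X vertices, either some vertex has X neighbours of the required kind among the
-- remaining ones, or t vertices that failed form a homogeneous set.  Starting from tᵐ⁻¹ ≤ n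
-- vertices, the m − 1 steps cannot all succeed, so a homogeneous set of size t = ⌊n^{1/(m−1)}⌋ exists,
-- and n < (t+1)^{m−1} ≤ 2^{m−1} t^{m−1}.

open import Defs hiding (sym)
open import Data.Nat using (ℕ; _*_; _^_; _∸_; _≤_; _<_)
open import Data.Nat.Combinatorics using (_C_)
open import Data.Fin.Subset using (∣_∣)
open import Data.Product using (_×_; ∃-syntax)

open import Data.Nat using (zero; suc; _+_; _<ᵇ_; NonZero; z≤n; s≤s; >-nonZero)
open import Data.Nat.Properties hiding (_≟_)
open import Data.Nat.Combinatorics using (nC1≡n; nCk+nC[k+1]≡[n+1]C[k+1])
open import Data.Nat.ListAction using (sum)
open import Data.Bool using (Bool; true; false; not; _∧_; _∨_; if_then_else_; T)
open import Data.Bool.Properties using (¬-not) renaming (_≟_ to _≟ᵇ_)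
open import Data.Unit using (tt)
open import Data.Empty using (⊥-elim)
open import Data.Fin using (Fin; zero; suc; toℕ; _≟_)
open import Data.Fin.Properties using (toℕ-injective)
open import Data.Fin.Subset using (Subset) renaming (_∈_ to _∈ₛ_)
import Data.Vec as Vec
open import Data.Vec.Properties using (lookup∘tabulate; []=⇒lookup)
open import Data.List using (List; []; _∷_; map; length; replicate; filter; allFin; tabulate)
open import Data.List.Properties
  using (map-tabulate; map-cong; map-cong-local; length-replicate; length-tabulate)
open import Data.List.Membership.Propositional using (_∈_; _∉_)
open import Data.List.Membership.Propositional.Properties using (∈-filter⁻)
open import Data.List.Relation.Unary.Any using (here; there)
open import Data.List.Relation.Unary.All as All using (All; []; _∷_)
open import Data.List.Relation.Unary.All.Properties using (¬Any⇒All¬; anti-mono)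
open import Data.List.Relation.Unary.Unique.Propositional using (Unique; []; _∷_)
import Data.List.Relation.Unary.Unique.Propositional.Properties as Unique
open import Data.List.Relation.Binary.Subset.Propositional using (_⊆_)
open import Data.List.Relation.Binary.Subset.Propositional.Properties using (filter-⊆; xs⊆x∷xs; ∈-∷⁺ʳ)
open import Data.Product using (_,_; proj₂)
open import Data.Sum using (_⊎_; inj₁; inj₂)
open import Function using (_∘_; id)
open import Relation.Nullary using (yes; no; does)
open import Relation.Nullary.Decidable using (dec-false)
open import Relation.Unary using (Pred; Decidable)
open import Relation.Unary.Properties using (∁?)
open import Relation.Binary.PropositionalEquality
open import Algebra.Properties.Semiring.Sum +-*-semiring
  using (sum-syntax; sum-cong-≗; ∑-distrib-+; ∑-comm; sum-replicate-zero; *-distribˡ-sum)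
open import Algebra.Properties.CommutativeSemigroup +-commutativeSemigroup
  using () renaming (interchange to +-interchange)
open import Algebra.Properties.CommutativeSemigroup *-commutativeSemigroup
  using (x∙yz≈y∙xz) renaming (interchange to *-interchange)
open ≡-Reasoning

𝟙 : Bool → ℕ
𝟙 b = if b then 1 else 0

𝟙-∧ : ∀ a b → 𝟙 (a ∧ b) ≡ 𝟙 a * 𝟙 b
𝟙-∧ false b = refl
𝟙-∧ true  b = sym (+-identityʳ (𝟙 b))

𝟙-∨ : ∀ a b → (a ≡ true → b ≡ false) → 𝟙 (a ∨ b) ≡ 𝟙 a + 𝟙 b
𝟙-∨ false b _    = refl
𝟙-∨ true  b a⇒¬b rewrite a⇒¬b refl = refl

sum-tabulate : ∀ {n} (h : Fin n → ℕ) → sum (tabulate h) ≡ ∑[ i < n ] h i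
sum-tabulate {zero}  h = refl
sum-tabulate {suc n} h = cong (h zero +_) (sum-tabulate (h ∘ suc))

sum-allFin : ∀ {n} (h : Fin n → ℕ) → sum (map h (allFin n)) ≡ ∑[ i < n ] h i
sum-allFin h = trans (cong sum (map-tabulate id h)) (sum-tabulate h)

∣tabulate∣ : ∀ {n} (χ : Fin n → Bool) → ∣ Vec.tabulate χ ∣ ≡ ∑[ i < n ] 𝟙 (χ i)
∣tabulate∣ {zero}  χ = refl
∣tabulate∣ {suc n} χ with χ zero
... | true  = cong suc (∣tabulate∣ (χ ∘ suc))
... | false = ∣tabulate∣ (χ ∘ suc)

∑-delta : ∀ {n} (v : Fin n) (g : Fin n → ℕ) → ∑[ i < n ] (𝟙 (does (i ≟ v)) * g i) ≡ g v
∑-delta {suc n} zero    g = begin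
  (g zero + 0) + ∑[ i < n ] 0  ≡⟨ cong₂ _+_ (+-identityʳ (g zero)) (sum-replicate-zero n) ⟩
  g zero + 0                   ≡⟨ +-identityʳ (g zero) ⟩
  g zero                       ∎
∑-delta {suc n} (suc v) g = ∑-delta v (g ∘ suc)

<ᵇ≡true⇒< : ∀ {a b} → (a <ᵇ b) ≡ true → a < b
<ᵇ≡true⇒< {a} {b} eq = <ᵇ⇒< a b (subst T (sym eq) tt)

<ᵇ≡false⇒≥ : ∀ {a b} → (a <ᵇ b) ≡ false → b ≤ a
<ᵇ≡false⇒≥ eq = ≮⇒≥ (λ a<b → subst T eq (<⇒<ᵇ a<b))

𝟙[<]*x+𝟙[>]*x≡x : ∀ {n} (i j : Fin n) x → (i ≡ j → x ≡ 0) →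
  𝟙 (toℕ i <ᵇ toℕ j) * x + 𝟙 (toℕ j <ᵇ toℕ i) * x ≡ x
𝟙[<]*x+𝟙[>]*x≡x i j x diag with toℕ i <ᵇ toℕ j in i<j | toℕ j <ᵇ toℕ i in j<i
... | true  | true  = ⊥-elim (<-asym (<ᵇ≡true⇒< {toℕ i} i<j) (<ᵇ≡true⇒< {toℕ j} j<i))
... | true  | false = trans (+-identityʳ (x + 0)) (+-identityʳ x)
... | false | true  = +-identityʳ x
... | false | false =
  sym (diag (toℕ-injective (≤-antisym (<ᵇ≡false⇒≥ {toℕ j} j<i) (<ᵇ≡false⇒≥ {toℕ i} i<j))))

∑-upper-triangle : ∀ {n} (w : Fin n → Fin n → ℕ) → (∀ i j → w i j ≡ w j i) → (∀ i → w i i ≡ 0) →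
  2 * (∑[ i < n ] ∑[ j < n ] (𝟙 (toℕ i <ᵇ toℕ j) * w i j)) ≡ ∑[ i < n ] ∑[ j < n ] w i j
∑-upper-triangle {n} w w-sym w-diag = begin
  2 * upper
    ≡⟨ cong (upper +_) (trans (+-identityʳ upper) upper≡lower) ⟩
  upper + lower
    ≡⟨ sym (∑-distrib-+ (λ i → ∑[ j < n ] below i j) (λ i → ∑[ j < n ] above i j)) ⟩
  ∑[ i < n ] (∑[ j < n ] below i j + ∑[ j < n ] above i j)
    ≡⟨ sum-cong-≗ (λ i → sym (∑-distrib-+ (below i) (above i))) ⟩
  ∑[ i < n ] ∑[ j < n ] (below i j + above i j)
    ≡⟨ sum-cong-≗ (λ i → sum-cong-≗ (below+above i)) ⟩
  ∑[ i < n ] ∑[ j < n ] w i j ∎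
  where
  below above : Fin n → Fin n → ℕ
  below i j = 𝟙 (toℕ i <ᵇ toℕ j) * w i j
  above i j = 𝟙 (toℕ j <ᵇ toℕ i) * w i j
  below+above : ∀ i j → below i j + above i j ≡ w i j
  below+above i j = 𝟙[<]*x+𝟙[>]*x≡x i j (w i j) λ { refl → w-diag i }
  upper lower : ℕ
  upper = ∑[ i < n ] ∑[ j < n ] below i j
  lower = ∑[ i < n ] ∑[ j < n ] above i j
  upper≡lower : upper ≡ lower
  upper≡lower = trans (∑-comm below)
    (sum-cong-≗ λ i → sum-cong-≗ λ j → cong (𝟙 (toℕ j <ᵇ toℕ i) *_) (w-sym j i))

sum-map-const : ∀ {A : Set} c (xs : List A) → sum (map (λ _ → c) xs) ≡ c * length xs
sum-map-const c []       = sym (*-zeroʳ c)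
sum-map-const c (x ∷ xs) = trans (cong (c +_) (sum-map-const c xs)) (sym (*-suc c (length xs)))

sum-map-+ : ∀ {A : Set} (f g : A → ℕ) xs →
  sum (map (λ x → f x + g x) xs) ≡ sum (map f xs) + sum (map g xs)
sum-map-+ f g []       = refl
sum-map-+ f g (x ∷ xs) = trans (cong (f x + g x +_) (sum-map-+ f g xs)) (+-interchange (f x) (g x) _ _)

length-filter+length-filter-∁ : ∀ {a p} {A : Set a} {P : Pred A p} (P? : Decidable P) xs →
  length (filter P? xs) + length (filter (∁? P?) xs) ≡ length xs
length-filter+length-filter-∁ P? []       = refl
length-filter+length-filter-∁ P? (x ∷ xs) with does (P? x)
... | true  = cong suc (length-filter+length-filter-∁ P? xs)
... | false = trans (+-suc _ _) (cong suc (length-filter+length-filter-∁ P? xs))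

a<x⇒x+c≤1+a+b⇒c≤b : ∀ {a b c x} → a < x → x + c ≤ suc (a + b) → c ≤ b
a<x⇒x+c≤1+a+b⇒c≤b {b = b} {c} {x} a<x x+c≤ = +-cancelˡ-≤ x c b (≤-trans x+c≤ (+-monoˡ-≤ b a<x))

twice-inducedEdges : ∀ {n} (G : Graph n) (S : Subset n) →
  2 * inducedEdges G S ≡ ∑[ i < n ] ∑[ j < n ] (𝟙 (Vec.lookup S i) * (𝟙 (Vec.lookup S j) * 𝟙 (adj G i j)))
twice-inducedEdges {n} G S = begin
  2 * inducedEdges G S                                       ≡⟨ cong (2 *_) ordered ⟩
  2 * (∑[ i < n ] ∑[ j < n ] (𝟙 (toℕ i <ᵇ toℕ j) * w i j))  ≡⟨ ∑-upper-triangle w w-sym w-diag ⟩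
  ∑[ i < n ] ∑[ j < n ] w i j                                ∎
  where
  s : Fin n → Bool
  s = Vec.lookup S
  w : Fin n → Fin n → ℕ
  w i j = 𝟙 (s i) * (𝟙 (s j) * 𝟙 (adj G i j))
  w-sym : ∀ i j → w i j ≡ w j i
  w-sym i j = trans (x∙yz≈y∙xz (𝟙 (s i)) (𝟙 (s j)) _)
    (cong (λ b → 𝟙 (s j) * (𝟙 (s i) * 𝟙 b)) (Graph.sym G i j))
  w-diag : ∀ i → w i i ≡ 0
  w-diag i rewrite irrefl G i = trans (cong (𝟙 (s i) *_) (*-zeroʳ (𝟙 (s i)))) (*-zeroʳ (𝟙 (s i)))
  term : ∀ i j → 𝟙 ((toℕ i <ᵇ toℕ j) ∧ s i ∧ s j ∧ adj G i j) ≡ 𝟙 (toℕ i <ᵇ toℕ j) * w i j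
  term i j = trans (𝟙-∧ (toℕ i <ᵇ toℕ j) _)
    (cong (𝟙 (toℕ i <ᵇ toℕ j) *_) (trans (𝟙-∧ (s i) _) (cong (𝟙 (s i) *_) (𝟙-∧ (s j) (adj G i j)))))
  ordered : inducedEdges G S ≡ ∑[ i < n ] ∑[ j < n ] (𝟙 (toℕ i <ᵇ toℕ j) * w i j)
  ordered = trans (sum-allFin {n} _) (sum-cong-≗ λ i → trans (sum-allFin {n} _) (sum-cong-≗ (term i)))

module _ {n : ℕ} where
  open import Data.List.Membership.DecPropositional (_≟_ {n}) using (_∈?_)

  toSubset : List (Fin n) → Subset n
  toSubset xs = Vec.tabulate (λ i → does (i ∈? xs))

  ∈-toSubset⁻ : ∀ {i xs} → i ∈ₛ toSubset xs → i ∈ xs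
  ∈-toSubset⁻ {i} {xs} i∈
    with i ∈? xs | trans (sym (lookup∘tabulate (λ j → does (j ∈? xs)) i)) ([]=⇒lookup i∈)
  ... | yes i∈xs | _ = i∈xs

  ∑-toSubset : ∀ {xs} → Unique xs → (g : Fin n → ℕ) →
    ∑[ i < n ] (𝟙 (does (i ∈? xs)) * g i) ≡ sum (map g xs)
  ∑-toSubset []                 g = sum-replicate-zero n
  ∑-toSubset {v ∷ ys} u@(_ ∷ uys) g = begin
    ∑[ i < n ] (𝟙 (does (i ≟ v) ∨ does (i ∈? ys)) * g i)
      ≡⟨ sum-cong-≗ split ⟩
    ∑[ i < n ] (at-v i + in-ys i)
      ≡⟨ ∑-distrib-+ at-v in-ys ⟩
    ∑[ i < n ] at-v i + ∑[ i < n ] in-ys i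
      ≡⟨ cong₂ _+_ (∑-delta v g) (∑-toSubset uys g) ⟩
    g v + sum (map g ys) ∎
    where
    at-v in-ys : Fin n → ℕ
    at-v  i = 𝟙 (does (i ≟ v)) * g i
    in-ys i = 𝟙 (does (i ∈? ys)) * g i
    disjoint : ∀ i → does (i ≟ v) ≡ true → does (i ∈? ys) ≡ false
    disjoint i with i ≟ v
    ... | yes refl = λ _ → dec-false (v ∈? ys) (Unique.Unique[x∷xs]⇒x∉xs u)
    split : ∀ i → 𝟙 (does (i ≟ v) ∨ does (i ∈? ys)) * g i ≡ at-v i + in-ys i
    split i = trans (cong (_* g i) (𝟙-∨ _ _ (disjoint i)))
                    (*-distribʳ-+ (g i) (𝟙 (does (i ≟ v))) (𝟙 (does (i ∈? ys))))

  ∣toSubset∣ : ∀ {xs} → Unique xs → ∣ toSubset xs ∣ ≡ length xs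
  ∣toSubset∣ {xs} u = begin
    ∣ toSubset xs ∣                      ≡⟨ ∣tabulate∣ χ ⟩
    ∑[ i < n ] 𝟙 (χ i)                   ≡⟨ sum-cong-≗ (λ i → sym (*-identityʳ (𝟙 (χ i)))) ⟩
    ∑[ i < n ] (𝟙 (χ i) * 1)             ≡⟨ ∑-toSubset u (λ _ → 1) ⟩
    sum (map (λ _ → 1) xs)               ≡⟨ sum-map-const 1 xs ⟩
    1 * length xs                        ≡⟨ *-identityˡ (length xs) ⟩
    length xs                            ∎
    where
    χ : Fin n → Bool
    χ i = does (i ∈? xs)

  degreeIn : Graph n → Fin n → List (Fin n) → ℕ
  degreeIn G v ys = sum (map (λ w → 𝟙 (adj G v w)) ys)

  adjacentPairs : Graph n → List (Fin n) → ℕ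
  adjacentPairs G xs = sum (map (λ u → degreeIn G u xs) xs)

  twice-inducedEdges-toSubset : (G : Graph n) → ∀ {xs} → Unique xs →
    2 * inducedEdges G (toSubset xs) ≡ adjacentPairs G xs
  twice-inducedEdges-toSubset G {xs} u = begin
    2 * inducedEdges G (toSubset xs)
      ≡⟨ twice-inducedEdges G (toSubset xs) ⟩
    ∑[ i < n ] ∑[ j < n ] (𝟙 (s i) * (𝟙 (s j) * 𝟙 (adj G i j)))
      ≡⟨ sum-cong-≗ factor ⟩
    ∑[ i < n ] (𝟙 (χ i) * degreeᵢ i)
      ≡⟨ ∑-toSubset u degreeᵢ ⟩
    sum (map degreeᵢ xs)
      ≡⟨ cong sum (map-cong (λ v → ∑-toSubset u (λ j → 𝟙 (adj G v j))) xs) ⟩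
    adjacentPairs G xs ∎
    where
    s χ : Fin n → Bool
    s   = Vec.lookup (toSubset xs)
    χ i = does (i ∈? xs)
    degreeᵢ : Fin n → ℕ
    degreeᵢ i = ∑[ j < n ] (𝟙 (χ j) * 𝟙 (adj G i j))
    factor : ∀ i → ∑[ j < n ] (𝟙 (s i) * (𝟙 (s j) * 𝟙 (adj G i j))) ≡ 𝟙 (χ i) * degreeᵢ i
    factor i = trans
      (sum-cong-≗ λ j → cong₂ (λ a b → 𝟙 a * (𝟙 b * 𝟙 (adj G i j)))
                                (lookup∘tabulate χ i) (lookup∘tabulate χ j))
      (sym (*-distribˡ-sum (𝟙 (χ i)) (λ j → 𝟙 (χ j) * 𝟙 (adj G i j))))

thresholdEdges : List Bool → ℕ
thresholdEdges []       = 0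
thresholdEdges (e ∷ es) = 𝟙 e * length es + thresholdEdges es

module _ {n} (G : Graph n) where

  -- Threshold es (v₁ ∷ … ∷ vₖ): distinct vertices with adj vᵢ vⱼ ≡ eᵢ for all i < j, i.e. an induced
  -- threshold graph with creation sequence es.  Homogeneous sets are the case es = replicate k c.
  data Threshold : List Bool → List (Fin n) → Set where
    []   : Threshold [] []
    cons : ∀ {e es v xs} → v ∉ xs → All (λ u → adj G v u ≡ e) xs → Threshold es xs →
           Threshold (e ∷ es) (v ∷ xs)

  Threshold⇒Unique : ∀ {es xs} → Threshold es xs → Unique xs
  Threshold⇒Unique []                      = []
  Threshold⇒Unique (cons {xs = xs} v∉ _ t) = ¬Any⇒All¬ xs v∉ ∷ Threshold⇒Unique t

  length-Threshold : ∀ {es xs} → Threshold es xs → length xs ≡ length es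
  length-Threshold []           = refl
  length-Threshold (cons _ _ t) = cong suc (length-Threshold t)

  degreeIn-All : ∀ {v e ys} → All (λ u → adj G v u ≡ e) ys → degreeIn G v ys ≡ 𝟙 e * length ys
  degreeIn-All {e = e} {ys} joined =
    trans (cong sum (map-cong-local (All.map (cong 𝟙) joined))) (sum-map-const (𝟙 e) ys)

  adjacentPairs-∷ : ∀ v ys → adjacentPairs G (v ∷ ys) ≡ 2 * degreeIn G v ys + adjacentPairs G ys
  adjacentPairs-∷ v ys = begin
    𝟙 (adj G v v) + d + sum (map (λ u → 𝟙 (adj G u v) + degreeIn G u ys) ys)
      ≡⟨ cong₂ _+_ (cong (λ b → 𝟙 b + d) (irrefl G v))
                   (sum-map-+ (λ u → 𝟙 (adj G u v)) (λ u → degreeIn G u ys) ys) ⟩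
    d + (sum (map (λ u → 𝟙 (adj G u v)) ys) + adjacentPairs G ys)
      ≡⟨ cong (λ d′ → d + (sum d′ + adjacentPairs G ys)) (map-cong (λ u → cong 𝟙 (Graph.sym G u v)) ys) ⟩
    d + (d + adjacentPairs G ys)
      ≡⟨ sym (+-assoc d d _) ⟩
    d + d + adjacentPairs G ys
      ≡⟨ cong (λ x → d + x + adjacentPairs G ys) (sym (+-identityʳ d)) ⟩
    2 * d + adjacentPairs G ys ∎
    where
    d = degreeIn G v ys

  adjacentPairs-Threshold : ∀ {es xs} → Threshold es xs → adjacentPairs G xs ≡ 2 * thresholdEdges es
  adjacentPairs-Threshold []                                  = refl
  adjacentPairs-Threshold {e ∷ es} {v ∷ ys} (cons _ joined t) = begin
    adjacentPairs G (v ∷ ys)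
      ≡⟨ adjacentPairs-∷ v ys ⟩
    2 * degreeIn G v ys + adjacentPairs G ys
      ≡⟨ cong₂ (λ d p → 2 * d + p) (degreeIn-All joined) (adjacentPairs-Threshold t) ⟩
    2 * (𝟙 e * length ys) + 2 * thresholdEdges es
      ≡⟨ cong (λ l → 2 * (𝟙 e * l) + 2 * thresholdEdges es) (length-Threshold t) ⟩
    2 * (𝟙 e * length es) + 2 * thresholdEdges es
      ≡⟨ sym (*-distribˡ-+ 2 (𝟙 e * length es) _) ⟩
    2 * thresholdEdges (e ∷ es) ∎

  inducedEdges-Threshold : ∀ {es xs} → Threshold es xs → inducedEdges G (toSubset xs) ≡ thresholdEdges es
  inducedEdges-Threshold t = *-cancelˡ-≡ _ _ 2
    (trans (twice-inducedEdges-toSubset G (Threshold⇒Unique t)) (adjacentPairs-Threshold t))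

  ∣toSubset∣-Threshold : ∀ {es xs} → Threshold es xs → ∣ toSubset xs ∣ ≡ length es
  ∣toSubset∣-Threshold t = trans (∣toSubset∣ (Threshold⇒Unique t)) (length-Threshold t)

  adj-Threshold-replicate : ∀ {k c I u w} → Threshold (replicate k c) I →
    u ∈ I → w ∈ I → u ≢ w → adj G u w ≡ c
  adj-Threshold-replicate {suc k} (cons _ _ _)      (here refl) (here refl) u≢w = ⊥-elim (u≢w refl)
  adj-Threshold-replicate {suc k} (cons _ joined _) (here refl) (there w∈)  _   = All.lookup joined w∈
  adj-Threshold-replicate {suc k} {u = u} (cons _ joined _) (there u∈) (here refl) _ =
    trans (Graph.sym G u _) (All.lookup joined u∈)
  adj-Threshold-replicate {suc k} (cons _ _ t) (there u∈) (there w∈) u≢w = adj-Threshold-replicate t u∈ w∈ u≢w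

  Threshold-replicate⇒Homogeneous : ∀ {k c I} → Threshold (replicate k c) I → Homogeneous G (toSubset I)
  Threshold-replicate⇒Homogeneous {c = true}  t =
    inj₁ λ i j i∈ j∈ → adj-Threshold-replicate t (∈-toSubset⁻ i∈) (∈-toSubset⁻ j∈)
  Threshold-replicate⇒Homogeneous {c = false} t =
    inj₂ λ i j i∈ j∈ → adj-Threshold-replicate t (∈-toSubset⁻ i∈) (∈-toSubset⁻ j∈)

  record Star (e : Bool) (X : ℕ) (W : List (Fin n)) : Set where
    field
      centre  : Fin n
      leaves  : List (Fin n)
      centre∈ : centre ∈ W
      leaves⊆ : leaves ⊆ W
      centre∉ : centre ∉ leaves
      unique  : Unique leaves
      large   : X ≤ length leaves
      joined  : All (λ u → adj G centre u ≡ e) leaves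

  Star-⊆ : ∀ {e X W W′} → W ⊆ W′ → Star e X W → Star e X W′
  Star-⊆ W⊆W′ s = record
    { centre = centre ; leaves = leaves ; centre∈ = W⊆W′ centre∈ ; leaves⊆ = W⊆W′ ∘ leaves⊆
    ; centre∉ = centre∉ ; unique = unique ; large = large ; joined = joined }
    where open Star s

  joins? : ∀ e v → Decidable (λ u → adj G v u ≡ e)
  joins? e v u = adj G v u ≟ᵇ e

  -- Scan W, each time keeping only the non-e-neighbours of the current vertex: a vertex with X
  -- e-neighbours in the remaining pool is a star centre, and the vertices passed over are pairwise
  -- (not e)-adjacent; a pool of k·X vertices survives k such passes.
  homogeneous-or-star : ∀ e k X {W} → Unique W → 1 ≤ X → k * X ≤ length W →
    (∃[ I ] Threshold (replicate k (not e)) I × I ⊆ W) ⊎ Star e X W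
  homogeneous-or-star e zero    X _ _ _ = inj₁ ([] , [] , λ ())
  homogeneous-or-star e (suc k) X {[]} _ X≥1 kX≤0 = ⊥-elim (<⇒≱ X≥1 (m+n≤o⇒m≤o X kX≤0))
  homogeneous-or-star e (suc k) X {v ∷ T} u@(_ ∷ uT) X≥1 kX≤W with X ≤? length (filter (joins? e v) T)
  ... | yes X≤A = inj₂ record
    { centre  = v
    ; leaves  = filter (joins? e v) T
    ; centre∈ = here refl
    ; leaves⊆ = xs⊆x∷xs T v ∘ filter-⊆ (joins? e v) T
    ; centre∉ = Unique.Unique[x∷xs]⇒x∉xs u ∘ filter-⊆ (joins? e v) T
    ; unique  = Unique.filter⁺ (joins? e v) uT
    ; large   = X≤A
    ; joined  = All.tabulate (proj₂ ∘ ∈-filter⁻ (joins? e v) {xs = T})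
    }
  ... | no X≰A = extend (homogeneous-or-star e k X (Unique.filter⁺ misses? uT) X≥1 kX≤B)
    where
    misses? = ∁? (joins? e v)
    B = filter misses? T
    B⊆v∷T : B ⊆ v ∷ T
    B⊆v∷T = xs⊆x∷xs T v ∘ filter-⊆ misses? T
    kX≤B : k * X ≤ length B
    kX≤B = a<x⇒x+c≤1+a+b⇒c≤b (≰⇒> X≰A)
      (subst (λ l → X + k * X ≤ suc l) (sym (length-filter+length-filter-∁ (joins? e v) T)) kX≤W)
    extend : (∃[ I ] Threshold (replicate k (not e)) I × I ⊆ B) ⊎ Star e X B →
             (∃[ I ] Threshold (replicate (suc k) (not e)) I × I ⊆ v ∷ T) ⊎ Star e X (v ∷ T)
    extend (inj₂ s)             = inj₂ (Star-⊆ B⊆v∷T s)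
    extend (inj₁ (I , t , I⊆B)) =
      inj₁ (v ∷ I , cons v∉I joined t , ∈-∷⁺ʳ (here refl) (B⊆v∷T ∘ I⊆B))
      where
      v∉I : v ∉ I
      v∉I = Unique.Unique[x∷xs]⇒x∉xs u ∘ filter-⊆ misses? T ∘ I⊆B
      joined : All (λ w → adj G v w ≡ not e) I
      joined = All.tabulate (¬-not ∘ proj₂ ∘ ∈-filter⁻ misses? {xs = T} ∘ I⊆B)

  threshold-or-homogeneous : ∀ t .{{_ : NonZero t}} e es {W} → Unique W → t ^ length es ≤ length W →
    (∃[ c ] ∃[ I ] Threshold (replicate t c) I) ⊎ (∃[ xs ] Threshold (e ∷ es) xs × xs ⊆ W)
  threshold-or-homogeneous t e []        {v ∷ W} _ _ =
    inj₂ (v ∷ [] , cons (λ ()) [] [] , ∈-∷⁺ʳ (here refl) (λ ()))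
  threshold-or-homogeneous t e (e′ ∷ es) u tᵏ⁺¹≤W
    with homogeneous-or-star e t (t ^ length es) u (m^n>0 t (length es)) tᵏ⁺¹≤W
  ... | inj₁ (I , hom , _) = inj₁ (not e , I , hom)
  ... | inj₂ s with threshold-or-homogeneous t e′ es (Star.unique s) (Star.large s)
  ...   | inj₁ hom             = inj₁ hom
  ...   | inj₂ (xs , t′ , xs⊆) =
    inj₂ (centre ∷ xs , cons (centre∉ ∘ xs⊆) (anti-mono xs⊆ joined) t′ ,
          ∈-∷⁺ʳ centre∈ (leaves⊆ ∘ xs⊆))
    where open Star s

[1+m]C2≡m+mC2 : ∀ m → suc m C 2 ≡ m + m C 2
[1+m]C2≡m+mC2 m = trans (sym (nCk+nC[k+1]≡[n+1]C[k+1] m 1)) (cong (_+ m C 2) (nC1≡n m))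

f<m⇒f≤mC2 : ∀ {f m} → f < m → f ≤ m C 2
f<m⇒f≤mC2 {m = suc m} (s≤s f≤m) =
  ≤-trans f≤m (≤-trans (m≤m+n m (m C 2)) (≤-reflexive (sym ([1+m]C2≡m+mC2 m))))

-- f is written as a sum of distinct elements of {0, …, m − 1}, largest first.
thresholdSequence : ∀ m f → f ≤ m C 2 → ∃[ es ] length es ≡ m × thresholdEdges es ≡ f
thresholdSequence zero    f f≤0 = [] , refl , sym (n≤0⇒n≡0 f≤0)
thresholdSequence (suc m) f f≤ with m ≤? f
... | no  m≰f with thresholdSequence m f (f<m⇒f≤mC2 (≰⇒> m≰f))
...   | es , len , edges = false ∷ es , cong suc len , edges
thresholdSequence (suc m) f f≤ | yes m≤f with thresholdSequence m (f ∸ m) f∸m≤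
  where
  f∸m≤ : f ∸ m ≤ m C 2
  f∸m≤ = ≤-trans (∸-monoˡ-≤ m (≤-trans f≤ (≤-reflexive ([1+m]C2≡m+mC2 m))))
                 (≤-reflexive (m+n∸m≡n m (m C 2)))
...   | es , len , edges = true ∷ es , cong suc len ,
  trans (cong₂ _+_ (trans (*-identityˡ (length es)) len) edges) (m+[n∸m]≡n m≤f)

homogeneous-of-size : ∀ {N} (G : Graph N) {m f} → f ≤ suc m C 2 → MFFree G (suc m) f →
  ∀ t → 1 ≤ t → t ^ m ≤ N → ∃[ S ] Homogeneous G S × ∣ S ∣ ≡ t
homogeneous-of-size {N} G {m} {f} f≤ free t t≥1 tᵐ≤N with thresholdSequence (suc m) f f≤
... | e ∷ es , len , edges
  with threshold-or-homogeneous G t {{>-nonZero t≥1}} e es (Unique.allFin⁺ N)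
         (subst₂ (λ k l → t ^ k ≤ l) (sym (suc-injective len)) (sym (length-tabulate id)) tᵐ≤N)
...   | inj₁ (c , I , hom) =
  toSubset I , Threshold-replicate⇒Homogeneous G hom , trans (∣toSubset∣-Threshold G hom) (length-replicate t)
...   | inj₂ (xs , thr , _) =
  ⊥-elim (free (toSubset xs) (trans (∣toSubset∣-Threshold G thr) len) (trans (inducedEdges-Threshold G thr) edges))

^-distribʳ-* : ∀ a b k → (a * b) ^ k ≡ a ^ k * b ^ k
^-distribʳ-* a b zero    = refl
^-distribʳ-* a b (suc k) = trans (cong (a * b *_) (^-distribʳ-* a b k)) (*-interchange a b (a ^ k) (b ^ k))

[1+t]^k≤2^k*t^k : ∀ {t} → 1 ≤ t → ∀ k → suc t ^ k ≤ 2 ^ k * t ^ k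
[1+t]^k≤2^k*t^k {t} t≥1 k = ≤-trans (^-monoˡ-≤ k 1+t≤2*t) (≤-reflexive (^-distribʳ-* 2 t k))
  where
  1+t≤2*t : suc t ≤ 2 * t
  1+t≤2*t = ≤-trans (+-monoˡ-≤ t t≥1) (≤-reflexive (cong (t +_) (sym (+-identityʳ t))))

integerRoot : ∀ k .{{_ : NonZero k}} n → ∃[ t ] 1 ≤ t × t ^ k ≤ suc n × suc n < suc t ^ k
integerRoot k zero    = 1 , ≤-refl , ≤-reflexive (^-zeroˡ k) , subst (_< 2 ^ k) (^-zeroˡ k) (^-monoˡ-< k (n<1+n 1))
integerRoot k (suc n) with integerRoot k n
... | t , t≥1 , tᵏ≤ , <[1+t]ᵏ with suc t ^ k ≤? suc (suc n)
...   | yes [1+t]ᵏ≤ = suc t , s≤s z≤n , [1+t]ᵏ≤ , ≤-<-trans <[1+t]ᵏ (^-monoˡ-< k (n<1+n (suc t)))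
...   | no  [1+t]ᵏ≰ = t , t≥1 , m≤n⇒m≤1+n tᵏ≤ , ≰⇒> [1+t]ᵏ≰

proposition1p3 : (m f : ℕ) → 2 ≤ m → f ≤ m C 2 →
    ∃[ a ] ∃[ b ] (1 ≤ a × 1 ≤ b ×
      ((n : ℕ) → 1 ≤ n → (G : Graph n) → MFFree G m f →
        ∃[ S ] (Homogeneous G S × a * n < b * ∣ S ∣ ^ (m ∸ 1))))
proposition1p3 (suc zero)    f (s≤s ()) _
proposition1p3 (suc (suc k)) f _ f≤ = 1 , 2 ^ suc k , ≤-refl , m^n>0 2 (suc k) , bound
  where
  bound : (n : ℕ) → 1 ≤ n → (G : Graph n) → MFFree G (suc (suc k)) f →
    ∃[ S ] (Homogeneous G S × 1 * n < 2 ^ suc k * ∣ S ∣ ^ suc k)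
  bound (suc n) _ G free with integerRoot (suc k) n
  ... | t , t≥1 , tᵏ≤ , <[1+t]ᵏ with homogeneous-of-size G f≤ free t t≥1 tᵏ≤
  ...   | S , hom , refl = S , hom ,
    subst (_< 2 ^ suc k * t ^ suc k) (sym (*-identityˡ (suc n)))
          (<-≤-trans <[1+t]ᵏ ([1+t]^k≤2^k*t^k t≥1 (suc k)))
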